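{- Let $(\Gamma,N)$ be a link-regular numbered graph and let $\sigma,\sigma'$ be cliques of $\Gamma$ with $N(\sigma)=N(\sigma')$. Then for any $\tau\subseteq\sigma$ and $\tau'\subseteq\sigma'$ with $N(\tau)=N(\tau')$, we have $N(\mathrm{Lk}(\sigma;\tau))=N(\mathrm{Lk}(\sigma';\tau'))$ as multisets.
   Context: A numbered graph $(\Gamma,N)$ is a finite simplicial graph with a map $N:V\Gamma\to\{2,3,\dots\}$. A clique is a vertex set spanning a complete subgraph (possibly empty); $\mathrm{Lk}(\sigma)=\{v\in V\Gamma\setminus\sigma\mid\sigma\cup\{v\}\text{ is a clique}\}$, and $\mathrm{Lk}(v)=\mathrm{Lk}(\{v\})$. For a clique $\sigma$ and $\tau\subseteq\sigma$, $\mathrm{Lk}(\sigma;\tau)=\{v\in V\Gamma\setminus\sigma\mid\mathrm{Lk}(v)\cap\sigma=\tau\}$. For $U\subseteq V\Gamma$, $N(U)$ is the multiset $\{N(v)\mid v\in U\}$. $(\Gamma,N)$ is link-regular if $N(\sigma_1)=N(\sigma_2)$ implies $N(\mathrm{Lk}(\sigma_1))=N(\mathrm{Lk}(\sigma_2))$ for all cliques $\sigma_1,\sigma_2$. -}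

module Defs where

open import Data.Nat using (ℕ; _≥_)
open import Data.Bool using (Bool; true; false; _∧_; _∨_; not; T; if_then_else_)
open import Data.Bool.Properties using () renaming (_≟_ to _≟ᵇ_)
open import Data.Fin using (Fin; _≟_)
open import Data.Fin.Subset using (Subset; _∈_; _⊆_; _∪_; _∩_; ⁅_⁆)
open import Data.Vec using (tabulate; lookup)
open import Data.List using (List; map; filterᵇ; allFin)
open import Data.Bool.ListAction using (all)
open import Data.List.Relation.Binary.Permutation.Propositional using (_↭_)
open import Relation.Nullary using (¬_)
open import Relation.Nullary.Decidable using (⌊_⌋)
open import Relation.Binary.PropositionalEquality using (_≡_)

record Graph (n : ℕ) : Set where
  field
    adj   : Fin n → Fin n → Bool
    sym   : ∀ u v → adj u v ≡ adj v u
    irrfl : ∀ v → adj v v ≡ false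
open Graph public

record NumberedGraph (n : ℕ) : Set where
  field
    graph : Graph n
    N     : Fin n → ℕ
    N≥2   : ∀ v → N v ≥ 2
open NumberedGraph public

allV : {n : ℕ} → (Fin n → Bool) → Bool
allV {n} f = all f (allFin n)

mem : {n : ℕ} → Fin n → Subset n → Bool
mem v σ = lookup σ v

module _ {n : ℕ} (G : NumberedGraph n) where

  private
    Γ = graph G

  IsClique : Subset n → Set
  IsClique σ = ∀ u v → u ∈ σ → v ∈ σ → ¬ (u ≡ v) → T (adj Γ u v)

  isClique? : Subset n → Bool
  isClique? σ = allV (λ u → allV (λ v →
                  not (mem u σ ∧ mem v σ) ∨ ⌊ u ≟ v ⌋ ∨ adj Γ u v))

  Lk : Subset n → Subset n
  Lk σ = tabulate λ v → not (mem v σ) ∧ isClique? (σ ∪ ⁅ v ⁆)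

  LkV : Fin n → Subset n
  LkV v = Lk ⁅ v ⁆

  LkRel : Subset n → Subset n → Subset n
  LkRel σ τ = tabulate λ v → not (mem v σ) ∧
                allV (λ w → ⌊ mem w (LkV v ∩ σ) ≟ᵇ mem w τ ⌋)

  -- N(U): the multiset of labels of U, as a list (multiset equality = ↭).
  NU : Subset n → List ℕ
  NU U = map (N G) (filterᵇ (λ v → mem v U) (allFin n))

  _≈N_ : Subset n → Subset n → Set
  U₁ ≈N U₂ = NU U₁ ↭ NU U₂

  LinkRegular : Set
  LinkRegular = ∀ σ₁ σ₂ → IsClique σ₁ → IsClique σ₂ →
                σ₁ ≈N σ₂ → Lk σ₁ ≈N Lk σ₂

-- Induction on the number of vertices of σ ∖ τ.  If τ = σ, then Lk(σ;σ) = Lk(σ) because σ is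
-- a clique, and link-regularity applies.  Otherwise pick u ∈ σ ∖ τ; since N(σ ∖ τ) = N(σ' ∖ τ')
-- there is u' ∈ σ' ∖ τ' with N(u') = N(u).  Apart from u itself, Lk(σ − u; τ) is the disjoint
-- union of Lk(σ; τ ∪ {u}) (its vertices adjacent to u) and Lk(σ; τ) (the others), and u lies in
-- Lk(σ − u; τ) iff τ = σ − u, a condition that transfers to the primed side.  The pairs
-- (σ − u, τ) and (σ, τ ∪ {u}) have smaller σ ∖ τ and match their primed counterparts label by
-- label, so the induction hypothesis and cancellation of multisets give the claim.

module Submission where

open import Defs hiding (sym)
open import Data.Nat using (ℕ; zero; suc)
open import Data.Nat.Properties using (suc-injective; 0≢1+n)
open import Data.Bool using (Bool; true; false; _∧_; _∨_; not; T)
open import Data.Bool.Properties using (T-∧; T-≡; ∧-zeroʳ; ∧-identityʳ; ∧-assoc) renaming (_≟_ to _≟ᵇ_)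
open import Data.Empty using (⊥-elim)
open import Data.Fin using (Fin; zero; suc; _≟_)
open import Data.Fin.Subset
  using (Subset; _∈_; _∉_; _⊆_; _∪_; _∩_; _─_; _-_; ⁅_⁆; ⊥)
open import Data.Fin.Subset.Properties
  using (⊆-antisym; _∈?_; nonempty?; Empty-unique; ∉⊥; x∈⁅x⁆; x∈⁅y⁆⇒x≡y; p⊆p∪q; q⊆p∪q; x∈p∪q⁻;
         x∈p∩q⁺; x∈p∩q⁻; p∩q⊆q; p─q⊆p; x∈p∧x∉q⇒x∈p─q; p─q─r≡p─r─q; p─q─r≡p─q∪r)
open import Data.Product using (_×_; _,_; proj₁; proj₂; ∃)
open import Data.Sum using (_⊎_; inj₁; inj₂; [_,_]′)
import Data.Vec as Vec
open import Data.Vec.Properties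
  using (lookup∘tabulate; tabulate∘lookup; tabulate-cong; lookup-zipWith; []=⇒lookup; lookup⇒[]=)
open import Data.List using (List; []; _∷_; [_]; map; filterᵇ; allFin; tabulate; _++_; length)
open import Data.List.Properties using (map-tabulate; map-++; filter-≐)
open import Data.List.Relation.Unary.All using (universal) renaming (lookup to All-lookup)
open import Data.List.Relation.Unary.All.Properties using (all⁺; all⁻)
open import Data.List.Membership.Propositional using () renaming (_∈_ to _∈ₗ_)
open import Data.List.Membership.Propositional.Properties
  using (∈-allFin; ∈-filter⁺; ∈-filter⁻; ∈-map⁺; ∈-map⁻)
open import Data.List.Relation.Binary.Permutation.Propositional
  using (_↭_; ↭-refl; ↭-reflexive; ↭-sym; ↭-trans; prep)
open import Data.List.Relation.Binary.Permutation.Propositional.Properties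
  using (shift; drop-∷; ++⁺; ++⁺ˡ; ++⁺ʳ; map⁺; ∈-resp-↭; ↭-length)
open import Function using (id; _∘_; case_of_; _⇔_; mk⇔; Equivalence)
open import Relation.Nullary using (yes; no; ¬_; Dec; contradiction)
open import Relation.Nullary.Decidable using (⌊_⌋; toWitness; fromWitness; T?)
open import Relation.Binary.PropositionalEquality
  using (_≡_; _≢_; refl; sym; trans; cong; cong₂; subst; subst₂; _≗_; module ≡-Reasoning)
open import Function.Properties.Equivalence using () renaming (sym to ⇔-sym; trans to ⇔-trans)

open Equivalence using (to; from)

private
  variable
    n : ℕ

module _ {a} {A : Set a} where

  filterᵇ-cong : {p q : A → Bool} → p ≗ q → filterᵇ p ≗ filterᵇ q
  filterᵇ-cong e = filter-≐ _ _ ((λ {x} → subst T (e x)) , (λ {x} → subst T (sym (e x))))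

  filterᵇ-split : ∀ (p q : A → Bool) xs →
    filterᵇ q xs ↭ filterᵇ (λ x → q x ∧ p x) xs ++ filterᵇ (λ x → q x ∧ not (p x)) xs
  filterᵇ-split p q [] = ↭-refl
  filterᵇ-split p q (x ∷ xs) with q x | p x
  ... | true  | true  = prep x (filterᵇ-split p q xs)
  ... | true  | false = ↭-trans (prep x (filterᵇ-split p q xs)) (↭-sym (shift x _ _))
  ... | false | _     = filterᵇ-split p q xs

  ++-cancelˡ-↭ : ∀ xs {ys zs : List A} → xs ++ ys ↭ xs ++ zs → ys ↭ zs
  ++-cancelˡ-↭ []        p = p
  ++-cancelˡ-↭ (x ∷ xs) p = ++-cancelˡ-↭ xs (drop-∷ p)

  ++-cancel-↭ : ∀ {xs xs' ys ys' : List A} → xs ↭ xs' → xs ++ ys ↭ xs' ++ ys' → ys ↭ ys'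
  ++-cancel-↭ {xs} {ys' = ys'} xs↭xs' p = ++-cancelˡ-↭ xs (↭-trans p (++⁺ʳ ys' (↭-sym xs↭xs')))

filterᵇ-map : ∀ {a b} {A : Set a} {B : Set b} (p : B → Bool) (f : A → B) xs →
  filterᵇ p (map f xs) ≡ map f (filterᵇ (p ∘ f) xs)
filterᵇ-map p f [] = refl
filterᵇ-map p f (x ∷ xs) with p (f x)
... | true  = cong (f x ∷_) (filterᵇ-map p f xs)
... | false = filterᵇ-map p f xs

T-not⇔¬T : ∀ {b} → T (not b) ⇔ (¬ T b)
T-not⇔¬T {true}  = mk⇔ (λ ()) (λ f → f _)
T-not⇔¬T {false} = mk⇔ (λ _ ()) (λ _ → _)

allV⇔ : {f : Fin n → Bool} → T (allV f) ⇔ (∀ v → T (f v))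
allV⇔ {n} {f} = mk⇔ (λ t v → All-lookup (all⁺ f (allFin n) t) (∈-allFin v))
                    (λ h → all⁻ f (universal h (allFin n)))

∈⇔T : {v : Fin n} {p : Subset n} → v ∈ p ⇔ T (mem v p)
∈⇔T {v = v} {p} = mk⇔ (from T-≡ ∘ []=⇒lookup) (lookup⇒[]= v p ∘ to T-≡)

∉⇔T-not : {v : Fin n} {p : Subset n} → v ∉ p ⇔ T (not (mem v p))
∉⇔T-not = mk⇔ (λ v∉p → from T-not⇔¬T (v∉p ∘ from ∈⇔T)) (λ t → to T-not⇔¬T t ∘ to ∈⇔T)

∈-tabulate⇔ : {f : Fin n → Bool} {v : Fin n} → v ∈ Vec.tabulate f ⇔ T (f v)
∈-tabulate⇔ {f = f} {v} = mk⇔ (subst T (lookup∘tabulate f v) ∘ to ∈⇔T)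
                              (from ∈⇔T ∘ subst T (sym (lookup∘tabulate f v)))

mem-ext : {p q : Subset n} → (∀ v → mem v p ≡ mem v q) → p ≡ q
mem-ext {p = p} {q} h = trans (sym (tabulate∘lookup p)) (trans (tabulate-cong h) (tabulate∘lookup q))

∈-ext : {p q : Subset n} → (∀ v → v ∈ p ⇔ v ∈ q) → p ≡ q
∈-ext h = ⊆-antisym (to (h _)) (from (h _))

allV-≟⇔≡ : {p q : Subset n} → T (allV (λ w → ⌊ mem w p ≟ᵇ mem w q ⌋)) ⇔ p ≡ q
allV-≟⇔≡ {p = p} {q} = mk⇔
  (λ t → mem-ext (λ w → toWitness (to allV⇔ t w)))
  (λ { refl → from (allV⇔ {f = λ w → ⌊ mem w p ≟ᵇ mem w p ⌋}) (λ w → fromWitness refl) })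

mem-∩ : (v : Fin n) (p q : Subset n) → mem v (p ∩ q) ≡ mem v p ∧ mem v q
mem-∩ v p q = lookup-zipWith _∧_ v p q

mem-─ : (v : Fin n) (p q : Subset n) → mem v (p ─ q) ≡ mem v p ∧ not (mem v q)
mem-─ zero    (x Vec.∷ p) (true  Vec.∷ q) = sym (∧-zeroʳ x)
mem-─ zero    (x Vec.∷ p) (false Vec.∷ q) = sym (∧-identityʳ x)
mem-─ (suc v) (x Vec.∷ p) (y     Vec.∷ q) = mem-─ v p q

∈─⇔ : {v : Fin n} {p q : Subset n} → v ∈ p ─ q ⇔ (v ∈ p × v ∉ q)
∈─⇔ {v = v} {p} {q} = mk⇔ split (λ (v∈p , v∉q) → x∈p∧x∉q⇒x∈p─q v∈p v∉q)
  where
  split : v ∈ p ─ q → v ∈ p × v ∉ q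
  split v∈ with to T-∧ (subst T (mem-─ v p q) (to ∈⇔T v∈))
  ... | t₁ , t₂ = from ∈⇔T t₁ , from ∉⇔T-not t₂

∈-minus⇔ : {u v : Fin n} {p : Subset n} → v ≢ u → v ∈ p - u ⇔ v ∈ p
∈-minus⇔ {u = u} {p = p} v≢u =
  mk⇔ (p─q⊆p p ⁅ u ⁆) (λ v∈p → x∈p∧x∉q⇒x∈p─q v∈p (v≢u ∘ x∈⁅y⁆⇒x≡y u))

x∉p-x : {x : Fin n} {p : Subset n} → x ∉ p - x
x∉p-x {x = x} x∈ = proj₂ (to ∈─⇔ x∈) (x∈⁅x⁆ x)

∩≡⇔⊆ : {p q : Subset n} → p ∩ q ≡ q ⇔ q ⊆ p
∩≡⇔⊆ {p = p} {q} =
  mk⇔ (λ e {x} x∈q → proj₁ (x∈p∩q⁻ p q (subst (x ∈_) (sym e) x∈q)))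
      (λ q⊆p → ⊆-antisym (p∩q⊆q p q) (λ x∈q → x∈p∩q⁺ (q⊆p x∈q , x∈q)))

∩⁅⁆-∈ : {u : Fin n} {p : Subset n} → u ∈ p → p ∩ ⁅ u ⁆ ≡ ⁅ u ⁆
∩⁅⁆-∈ {u = u} {p} u∈p = from ∩≡⇔⊆ (λ {x} x∈⁅u⁆ → subst (_∈ p) (sym (x∈⁅y⁆⇒x≡y u x∈⁅u⁆)) u∈p)

∩⁅⁆-∉ : {u : Fin n} {p : Subset n} → u ∉ p → p ∩ ⁅ u ⁆ ≡ ⊥
∩⁅⁆-∉ {u = u} {p} u∉p = Empty-unique λ (x , x∈) →
  let x∈p , x∈⁅u⁆ = x∈p∩q⁻ p ⁅ u ⁆ x∈ in u∉p (subst (_∈ p) (x∈⁅y⁆⇒x≡y u x∈⁅u⁆) x∈p)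

∩-minus : (u : Fin n) (p q : Subset n) → (p ∩ q) - u ≡ p ∩ (q - u)
∩-minus u p q = mem-ext λ v → begin
  mem v ((p ∩ q) - u)                    ≡⟨ mem-─ v (p ∩ q) ⁅ u ⁆ ⟩
  mem v (p ∩ q) ∧ not (mem v ⁅ u ⁆)      ≡⟨ cong (_∧ not (mem v ⁅ u ⁆)) (mem-∩ v p q) ⟩
  (mem v p ∧ mem v q) ∧ not (mem v ⁅ u ⁆) ≡⟨ ∧-assoc (mem v p) (mem v q) _ ⟩
  mem v p ∧ (mem v q ∧ not (mem v ⁅ u ⁆)) ≡⟨ cong (mem v p ∧_) (mem-─ v q ⁅ u ⁆) ⟨
  mem v p ∧ mem v (q - u)                ≡⟨ mem-∩ v p (q - u) ⟨
  mem v (p ∩ (q - u))                    ∎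
  where open ≡-Reasoning

∈-ext-split : {p q : Subset n} (u : Fin n) → (u ∈ p ⇔ u ∈ q) → (∀ v → v ≢ u → v ∈ p ⇔ v ∈ q) → p ≡ q
∈-ext-split u at-u off-u = ∈-ext λ v → case v ≟ u of λ
  { (yes refl) → at-u
  ; (no  v≢u)  → off-u v v≢u
  }

≡⇔-minus : {p q : Subset n} (u : Fin n) → p ≡ q ⇔ (p - u ≡ q - u × (u ∈ p ⇔ u ∈ q))
≡⇔-minus u = mk⇔ (λ { refl → refl , mk⇔ id id })
  λ (e , at-u) → ∈-ext-split u at-u λ v v≢u →
    mk⇔ (to (∈-minus⇔ v≢u) ∘ subst (v ∈_) e ∘ from (∈-minus⇔ v≢u))
        (to (∈-minus⇔ v≢u) ∘ subst (v ∈_) (sym e) ∘ from (∈-minus⇔ v≢u))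

minus-∉ : {u : Fin n} {p : Subset n} → u ∉ p → p - u ≡ p
minus-∉ {u = u} u∉p = ∈-ext-split u (mk⇔ (⊥-elim ∘ x∉p-x) (⊥-elim ∘ u∉p)) (λ v → ∈-minus⇔)

∪⁅⁆-minus : {u : Fin n} {p : Subset n} → u ∉ p → (p ∪ ⁅ u ⁆) - u ≡ p
∪⁅⁆-minus {u = u} {p} u∉p = ∈-ext-split u (mk⇔ (⊥-elim ∘ x∉p-x) (⊥-elim ∘ u∉p)) λ v v≢u →
  mk⇔ (λ v∈ → [ id , ⊥-elim ∘ v≢u ∘ x∈⁅y⁆⇒x≡y u ]′ (x∈p∪q⁻ p ⁅ u ⁆ (to (∈-minus⇔ v≢u) v∈)))
      (from (∈-minus⇔ v≢u) ∘ p⊆p∪q ⁅ u ⁆)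

─≡⊥⇔≡ : {σ τ : Subset n} → τ ⊆ σ → σ ─ τ ≡ ⊥ ⇔ σ ≡ τ
─≡⊥⇔≡ {σ = σ} {τ} τ⊆σ = mk⇔
  (λ e → ⊆-antisym (σ⊆τ e) τ⊆σ)
  (λ { refl → Empty-unique λ (x , x∈) → proj₂ (to ∈─⇔ x∈) (proj₁ (to ∈─⇔ x∈)) })
  where
  σ⊆τ : σ ─ τ ≡ ⊥ → σ ⊆ τ
  σ⊆τ e {x} x∈σ with x ∈? τ
  ... | yes x∈τ = x∈τ
  ... | no  x∉τ = ⊥-elim (∉⊥ (subst (x ∈_) e (x∈p∧x∉q⇒x∈p─q x∈σ x∉τ)))

members : Subset n → List (Fin n)
members {n} p = filterᵇ (λ v → mem v p) (allFin n)

-- allFin (suc n) unfolds to zero ∷ tabulate suc.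
members-suc : ∀ b (p : Subset n) → filterᵇ (λ v → mem v (b Vec.∷ p)) (tabulate suc) ≡ map suc (members p)
members-suc {n} b p = trans (cong (filterᵇ _) (sym (map-tabulate id suc))) (filterᵇ-map _ suc (allFin n))

members-⊥ : members (⊥ {n}) ≡ []
members-⊥ {zero}  = refl
members-⊥ {suc n} = trans (members-suc false ⊥) (cong (map suc) members-⊥)

members-⁅⁆ : (u : Fin n) → members ⁅ u ⁆ ≡ [ u ]
members-⁅⁆ zero    = cong (zero ∷_) (trans (members-suc true ⊥) (cong (map suc) members-⊥))
members-⁅⁆ (suc u) = trans (members-suc false ⁅ u ⁆) (cong (map suc) (members-⁅⁆ u))

T-clique-entry : ∀ {p} {P : Set p} x y (P? : Dec P) c →
  T (not (x ∧ y) ∨ ⌊ P? ⌋ ∨ c) ⇔ (T x → T y → ¬ P → T c)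
T-clique-entry false y      P?       c = mk⇔ (λ _ ()) (λ _ → _)
T-clique-entry true  false  P?       c = mk⇔ (λ _ _ ()) (λ _ → _)
T-clique-entry true  true   (yes p)  c = mk⇔ (λ _ _ _ ¬p → ⊥-elim (¬p p)) (λ _ → _)
T-clique-entry true  true   (no ¬p)  c = mk⇔ (λ t _ _ _ → t) (λ f → f _ _ ¬p)

module _ (G : NumberedGraph n) where

  Adjacent : Fin n → Fin n → Set
  Adjacent v w = T (adj (graph G) v w)

  Adjacent-sym : {v w : Fin n} → Adjacent v w → Adjacent w v
  Adjacent-sym {v} {w} = subst T (Graph.sym (graph G) v w)

  Adjacent-irrefl : {v : Fin n} → ¬ Adjacent v v
  Adjacent-irrefl {v} = subst T (irrfl (graph G) v)

  isClique?⇔ : {S : Subset n} → T (isClique? G S) ⇔ IsClique G S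
  isClique?⇔ {S} = mk⇔
    (λ t a b a∈ b∈ → to (entry a b) (to allV⇔ (to allV⇔ t a) b) (to ∈⇔T a∈) (to ∈⇔T b∈))
    (λ c → from allV⇔ λ a → from allV⇔ λ b →
      from (entry a b) λ ta tb → c a b (from ∈⇔T ta) (from ∈⇔T tb))
    where
    entry = λ a b → T-clique-entry (mem a S) (mem b S) (a ≟ b) (adj (graph G) a b)

  IsClique-⊆ : {σ σ' : Subset n} → σ' ⊆ σ → IsClique G σ → IsClique G σ'
  IsClique-⊆ σ'⊆σ c a b a∈ b∈ = c a b (σ'⊆σ a∈) (σ'⊆σ b∈)

  IsClique-∪⁅⁆⇔ : {σ : Subset n} {v : Fin n} → IsClique G σ → v ∉ σ →
    IsClique G (σ ∪ ⁅ v ⁆) ⇔ (∀ w → w ∈ σ → Adjacent v w)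
  IsClique-∪⁅⁆⇔ {σ} {v} c v∉σ = mk⇔
    (λ c' w w∈σ → c' v w (q⊆p∪q σ ⁅ v ⁆ (x∈⁅x⁆ v)) (p⊆p∪q ⁅ v ⁆ w∈σ)
                          (λ { refl → v∉σ w∈σ }))
    (λ h a b a∈ b∈ → edge h (x∈p∪q⁻ σ ⁅ v ⁆ a∈) (x∈p∪q⁻ σ ⁅ v ⁆ b∈))
    where
    edge : (∀ w → w ∈ σ → Adjacent v w) → ∀ {a b} →
      a ∈ σ ⊎ a ∈ ⁅ v ⁆ → b ∈ σ ⊎ b ∈ ⁅ v ⁆ → a ≢ b → Adjacent a b
    edge h (inj₁ a∈σ) (inj₁ b∈σ) a≢b = c _ _ a∈σ b∈σ a≢b
    edge h (inj₁ a∈σ) (inj₂ b∈v) a≢b rewrite x∈⁅y⁆⇒x≡y v b∈v = Adjacent-sym (h _ a∈σ)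
    edge h (inj₂ a∈v) (inj₁ b∈σ) a≢b rewrite x∈⁅y⁆⇒x≡y v a∈v = h _ b∈σ
    edge h (inj₂ a∈v) (inj₂ b∈v) a≢b = ⊥-elim (a≢b (trans (x∈⁅y⁆⇒x≡y v a∈v) (sym (x∈⁅y⁆⇒x≡y v b∈v))))

  ∈Lk⇔ : {σ : Subset n} {v : Fin n} → IsClique G σ →
    v ∈ Lk G σ ⇔ (v ∉ σ × ∀ w → w ∈ σ → Adjacent v w)
  ∈Lk⇔ {σ} {v} c = mk⇔
    (λ v∈ → let t₁ , t₂ = to T-∧ (to ∈-tabulate⇔ v∈)
                v∉σ = from ∉⇔T-not t₁
            in v∉σ , to (IsClique-∪⁅⁆⇔ c v∉σ) (to isClique?⇔ t₂))
    (λ (v∉σ , h) → from ∈-tabulate⇔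
      (from T-∧ (to ∉⇔T-not v∉σ , from isClique?⇔ (from (IsClique-∪⁅⁆⇔ c v∉σ) h))))

  ∈LkV⇔ : {v w : Fin n} → w ∈ LkV G v ⇔ Adjacent v w
  ∈LkV⇔ {v} {w} = mk⇔
    (λ w∈ → Adjacent-sym (proj₂ (to (∈Lk⇔ ⁅v⁆-clique) w∈) v (x∈⁅x⁆ v)))
    (λ vw → from (∈Lk⇔ ⁅v⁆-clique)
      ( (λ w∈⁅v⁆ → Adjacent-irrefl (subst (Adjacent v) (x∈⁅y⁆⇒x≡y v w∈⁅v⁆) vw))
        , (λ x x∈⁅v⁆ → subst (Adjacent w) (sym (x∈⁅y⁆⇒x≡y v x∈⁅v⁆)) (Adjacent-sym vw))))
    where
    ⁅v⁆-clique : IsClique G ⁅ v ⁆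
    ⁅v⁆-clique a b a∈ b∈ a≢b = ⊥-elim (a≢b (trans (x∈⁅y⁆⇒x≡y v a∈) (sym (x∈⁅y⁆⇒x≡y v b∈))))

  ∈LkRel⇔ : (σ τ : Subset n) {v : Fin n} → v ∈ LkRel G σ τ ⇔ (v ∉ σ × LkV G v ∩ σ ≡ τ)
  ∈LkRel⇔ σ τ = mk⇔
    (λ v∈ → let t₁ , t₂ = to T-∧ (to ∈-tabulate⇔ v∈) in from ∉⇔T-not t₁ , to allV-≟⇔≡ t₂)
    (λ (v∉σ , e) → from ∈-tabulate⇔ (from T-∧ (to ∉⇔T-not v∉σ , from allV-≟⇔≡ e)))

  LkRel-self : {σ : Subset n} → IsClique G σ → LkRel G σ σ ≡ Lk G σ
  LkRel-self {σ} c = ∈-ext λ v → mk⇔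
    (λ v∈ → let v∉σ , e = to (∈LkRel⇔ σ σ) v∈
            in from (∈Lk⇔ c) (v∉σ , λ w w∈σ → to ∈LkV⇔ (to ∩≡⇔⊆ e w∈σ)))
    (λ v∈ → let v∉σ , h = to (∈Lk⇔ c) v∈
            in from (∈LkRel⇔ σ σ) (v∉σ , from ∩≡⇔⊆ (λ {w} w∈σ → from ∈LkV⇔ (h w w∈σ))))

  LkRel-∉ : (σ τ : Subset n) {v : Fin n} → v ∈ LkRel G σ τ → v ∉ σ
  LkRel-∉ σ τ = proj₁ ∘ to (∈LkRel⇔ σ τ)

  ∈LkRel-minus⇔ : (σ τ : Subset n) {u v : Fin n} → u ∈ σ → v ≢ u →
    v ∈ LkRel G σ τ ⇔ (v ∈ LkRel G (σ - u) (τ - u) × (Adjacent v u ⇔ u ∈ τ))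
  ∈LkRel-minus⇔ σ τ {u} {v} u∈σ v≢u = mk⇔
    (λ v∈ → let v∉σ , e = to (∈LkRel⇔ σ τ) v∈
                e₋ , u⇔ = to (≡⇔-minus u) e
            in from (∈LkRel⇔ (σ - u) (τ - u))
                 (v∉σ ∘ to (∈-minus⇔ v≢u) , trans (sym (∩-minus u _ σ)) e₋)
             , ⇔-trans adj⇔ u⇔)
    (λ (v∈ , h) → let v∉σ₋ , e₋ = to (∈LkRel⇔ (σ - u) (τ - u)) v∈
                  in from (∈LkRel⇔ σ τ)
                       ( v∉σ₋ ∘ from (∈-minus⇔ v≢u)
                       , from (≡⇔-minus u) (trans (∩-minus u _ σ) e₋ , ⇔-trans (⇔-sym adj⇔) h)))
    where
    adj⇔ : Adjacent v u ⇔ u ∈ LkV G v ∩ σ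
    adj⇔ = mk⇔ (λ vu → x∈p∩q⁺ (from ∈LkV⇔ vu , u∈σ)) (λ u∈ → to ∈LkV⇔ (proj₁ (x∈p∩q⁻ _ _ u∈)))

  module _ {σ τ : Subset n} {u : Fin n} (u∈σ : u ∈ σ) (u∉τ : u ∉ τ) where

    private
      L₀ : Subset n
      L₀ = LkRel G (σ - u) τ

      u∉L₀-u : u ∉ L₀ - u
      u∉L₀-u = x∉p-x {p = L₀}

    LkRel-minus-∩ : (LkRel G (σ - u) τ - u) ∩ LkV G u ≡ LkRel G σ (τ ∪ ⁅ u ⁆)
    LkRel-minus-∩ = ∈-ext-split u
      (mk⇔ (⊥-elim ∘ u∉L₀-u ∘ proj₁ ∘ x∈p∩q⁻ _ _) (λ u∈ → ⊥-elim (LkRel-∉ σ (τ ∪ ⁅ u ⁆) u∈ u∈σ)))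
      λ v v≢u → mk⇔
        (λ v∈ → let v∈₀ , uv = x∈p∩q⁻ _ _ v∈ in from (∈LkRel-minus⇔ σ (τ ∪ ⁅ u ⁆) u∈σ v≢u)
          ( subst (λ t → v ∈ LkRel G (σ - u) t) (sym (∪⁅⁆-minus u∉τ)) (to (∈-minus⇔ v≢u) v∈₀)
          , mk⇔ (λ _ → u∈τ₁) (λ _ → Adjacent-sym (to ∈LkV⇔ uv))))
        (λ v∈ → let v∈₀ , h = to (∈LkRel-minus⇔ σ (τ ∪ ⁅ u ⁆) u∈σ v≢u) v∈ in x∈p∩q⁺
          ( from (∈-minus⇔ v≢u) (subst (λ t → v ∈ LkRel G (σ - u) t) (∪⁅⁆-minus u∉τ) v∈₀)
          , from ∈LkV⇔ (Adjacent-sym (from h u∈τ₁))))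
      where
      u∈τ₁ : u ∈ τ ∪ ⁅ u ⁆
      u∈τ₁ = q⊆p∪q τ ⁅ u ⁆ (x∈⁅x⁆ u)

    LkRel-minus-─ : (LkRel G (σ - u) τ - u) ─ LkV G u ≡ LkRel G σ τ
    LkRel-minus-─ = ∈-ext-split u
      (mk⇔ (⊥-elim ∘ u∉L₀-u ∘ proj₁ ∘ to ∈─⇔) (λ u∈ → ⊥-elim (LkRel-∉ σ τ u∈ u∈σ)))
      λ v v≢u → mk⇔
        (λ v∈ → let v∈₀ , ¬uv = to ∈─⇔ v∈ in from (∈LkRel-minus⇔ σ τ u∈σ v≢u)
          ( subst (λ t → v ∈ LkRel G (σ - u) t) (sym (minus-∉ u∉τ)) (to (∈-minus⇔ v≢u) v∈₀)
          , mk⇔ (λ vu → ⊥-elim (¬uv (from ∈LkV⇔ (Adjacent-sym vu)))) (⊥-elim ∘ u∉τ)))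
        (λ v∈ → let v∈₀ , h = to (∈LkRel-minus⇔ σ τ u∈σ v≢u) v∈ in from ∈─⇔
          ( from (∈-minus⇔ v≢u) (subst (λ t → v ∈ LkRel G (σ - u) t) (minus-∉ u∉τ) v∈₀)
          , u∉τ ∘ to h ∘ Adjacent-sym ∘ to ∈LkV⇔))

  u∈LkRel-minus⇔ : {σ τ : Subset n} {u : Fin n} → IsClique G σ → u ∈ σ → τ ⊆ σ - u →
    u ∈ LkRel G (σ - u) τ ⇔ (σ - u) ─ τ ≡ ⊥
  u∈LkRel-minus⇔ {σ} {τ} {u} c u∈σ τ⊆σ₋ = mk⇔
    (λ u∈ → from (─≡⊥⇔≡ τ⊆σ₋) (trans (sym adjacent-to-all) (proj₂ (to (∈LkRel⇔ (σ - u) τ) u∈))))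
    (λ e → from (∈LkRel⇔ (σ - u) τ) (x∉p-x , trans adjacent-to-all (to (─≡⊥⇔≡ τ⊆σ₋) e)))
    where
    adjacent-to-all : LkV G u ∩ (σ - u) ≡ σ - u
    adjacent-to-all = from ∩≡⇔⊆ λ {w} w∈ →
      from ∈LkV⇔ (c u w u∈σ (p─q⊆p σ ⁅ u ⁆ w∈) (λ { refl → x∉p-x w∈ }))

  NU-split : (U A : Subset n) → NU G U ↭ NU G (U ∩ A) ++ NU G (U ─ A)
  NU-split U A = ↭-trans (map⁺ (N G) (filterᵇ-split (λ v → mem v A) (λ v → mem v U) (allFin n)))
    (↭-reflexive (trans (map-++ (N G) (filterᵇ (λ v → mem v U ∧ mem v A) (allFin n))
                                      (filterᵇ (λ v → mem v U ∧ not (mem v A)) (allFin n)))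
      (cong₂ _++_ (cong (map (N G)) (filterᵇ-cong (λ v → sym (mem-∩ v U A)) (allFin n)))
                  (cong (map (N G)) (filterᵇ-cong (λ v → sym (mem-─ v U A)) (allFin n))))))

  NU-⁅⁆ : (u : Fin n) → NU G ⁅ u ⁆ ≡ [ N G u ]
  NU-⁅⁆ u = cong (map (N G)) (members-⁅⁆ u)

  NU-minus : {u : Fin n} {U : Subset n} → u ∈ U → NU G U ↭ N G u ∷ NU G (U - u)
  NU-minus {u} {U} u∈U = ↭-trans (NU-split U ⁅ u ⁆)
    (↭-reflexive (cong (_++ NU G (U - u)) (trans (cong (NU G) (∩⁅⁆-∈ u∈U)) (NU-⁅⁆ u))))

  NU-─ : {σ τ : Subset n} → τ ⊆ σ → NU G σ ↭ NU G τ ++ NU G (σ ─ τ)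
  NU-─ {σ} {τ} τ⊆σ = ↭-trans (NU-split σ τ)
    (↭-reflexive (cong (λ X → NU G X ++ NU G (σ ─ τ)) (from ∩≡⇔⊆ τ⊆σ)))

  NU-∩⁅⁆ : {p p' : Subset n} {u u' : Fin n} → (u ∈ p ⇔ u' ∈ p') → N G u ≡ N G u' →
    NU G (p ∩ ⁅ u ⁆) ≡ NU G (p' ∩ ⁅ u' ⁆)
  NU-∩⁅⁆ {p} {p'} {u} {u'} h Nu≡Nu' with u ∈? p
  ... | yes u∈p = begin
    NU G (p ∩ ⁅ u ⁆)   ≡⟨ cong (NU G) (∩⁅⁆-∈ u∈p) ⟩
    NU G ⁅ u ⁆         ≡⟨ NU-⁅⁆ u ⟩
    [ N G u ]          ≡⟨ cong [_] Nu≡Nu' ⟩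
    [ N G u' ]         ≡⟨ NU-⁅⁆ u' ⟨
    NU G ⁅ u' ⁆        ≡⟨ cong (NU G) (∩⁅⁆-∈ (to h u∈p)) ⟨
    NU G (p' ∩ ⁅ u' ⁆) ∎
    where open ≡-Reasoning
  ... | no  u∉p = trans (cong (NU G) (∩⁅⁆-∉ u∉p)) (cong (NU G) (sym (∩⁅⁆-∉ (u∉p ∘ from h))))

  ∈-NU⁺ : {v : Fin n} {U : Subset n} → v ∈ U → N G v ∈ₗ NU G U
  ∈-NU⁺ {U = U} v∈U = ∈-map⁺ (N G) (∈-filter⁺ (T? ∘ λ w → mem w U) (∈-allFin _) (to ∈⇔T v∈U))

  ∈-NU⁻ : {k : ℕ} {U : Subset n} → k ∈ₗ NU G U → ∃ λ v → v ∈ U × k ≡ N G v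
  ∈-NU⁻ {U = U} k∈ with ∈-map⁻ (N G) k∈
  ... | v , v∈ , k≡ =
    v , from ∈⇔T (proj₂ (∈-filter⁻ (T? ∘ λ w → mem w U) {xs = allFin n} v∈)) , k≡

  ≈N-match : {U U' : Subset n} {u : Fin n} → _≈N_ G U U' → u ∈ U →
    ∃ λ u' → u' ∈ U' × N G u ≡ N G u'
  ≈N-match U≈U' u∈U = ∈-NU⁻ (∈-resp-↭ U≈U' (∈-NU⁺ u∈U))

  ≈N-⊥ : {U U' : Subset n} → _≈N_ G U U' → U ≡ ⊥ → U' ≡ ⊥
  ≈N-⊥ {U' = U'} U≈U' refl =
    Empty-unique λ (v , v∈) → ∉⊥ (proj₁ (proj₂ (≈N-match {U = U'} (↭-sym U≈U') v∈)))

  record CliqueFace : Set where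
    field
      σ        : Subset n
      τ        : Subset n
      σ-clique : IsClique G σ
      τ⊆σ      : τ ⊆ σ

    gap : Subset n
    gap = σ ─ τ

    link : Subset n
    link = LkRel G σ τ

  open CliqueFace

  record _≃_ (F F' : CliqueFace) : Set where
    constructor _,_
    field
      σ≈ : _≈N_ G (σ F) (σ F')
      τ≈ : _≈N_ G (τ F) (τ F')

  gap-≃ : {F F' : CliqueFace} → F ≃ F' → _≈N_ G (gap F) (gap F')
  gap-≃ {F} {F'} (σ≈ , τ≈) =
    ++-cancel-↭ τ≈ (↭-trans (↭-sym (NU-─ (τ⊆σ F))) (↭-trans σ≈ (NU-─ (τ⊆σ F'))))

  module _ (F : CliqueFace) {u : Fin n} (u∈gap : u ∈ gap F) where

    private
      u∈σ : u ∈ σ F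
      u∈σ = proj₁ (to ∈─⇔ u∈gap)

      u∉τ : u ∉ τ F
      u∉τ = proj₂ (to ∈─⇔ u∈gap)

    delete : CliqueFace
    delete = record
      { σ        = σ F - u
      ; τ        = τ F
      ; σ-clique = IsClique-⊆ (p─q⊆p (σ F) ⁅ u ⁆) (σ-clique F)
      ; τ⊆σ      = λ w∈τ → from (∈-minus⇔ (λ { refl → u∉τ w∈τ })) (τ⊆σ F w∈τ)
      }

    insert : CliqueFace
    insert = record
      { σ        = σ F
      ; τ        = τ F ∪ ⁅ u ⁆
      ; σ-clique = σ-clique F
      ; τ⊆σ      = λ w∈ → [ τ⊆σ F , (λ w∈⁅u⁆ → subst (_∈ σ F) (sym (x∈⁅y⁆⇒x≡y u w∈⁅u⁆)) u∈σ) ]′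
                             (x∈p∪q⁻ (τ F) ⁅ u ⁆ w∈)
      }

    NU-gap-delete : NU G (gap F) ↭ N G u ∷ NU G (gap delete)
    NU-gap-delete = ↭-trans (NU-minus u∈gap)
      (↭-reflexive (cong (λ X → N G u ∷ NU G X) (p─q─r≡p─r─q (σ F) (τ F) ⁅ u ⁆)))

    gap-insert : gap insert ≡ gap delete
    gap-insert = trans (sym (p─q─r≡p─q∪r (σ F) (τ F) ⁅ u ⁆)) (p─q─r≡p─r─q (σ F) (τ F) ⁅ u ⁆)

    NU-τ-insert : NU G (τ insert) ↭ N G u ∷ NU G (τ F)
    NU-τ-insert = ↭-trans (NU-minus (q⊆p∪q (τ F) ⁅ u ⁆ (x∈⁅x⁆ u)))
      (↭-reflexive (cong (λ X → N G u ∷ NU G X) (∪⁅⁆-minus u∉τ)))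

    NU-link-delete :
      NU G (link delete) ↭ NU G (link delete ∩ ⁅ u ⁆) ++ (NU G (link insert) ++ NU G (link F))
    NU-link-delete = ↭-trans (NU-split (link delete) ⁅ u ⁆)
      (++⁺ˡ _ (↭-trans (NU-split (link delete - u) (LkV G u))
        (↭-reflexive (cong₂ (λ X Y → NU G X ++ NU G Y)
                            (LkRel-minus-∩ u∈σ u∉τ) (LkRel-minus-─ u∈σ u∉τ)))))

    u∈link-delete⇔ : u ∈ link delete ⇔ gap delete ≡ ⊥
    u∈link-delete⇔ = u∈LkRel-minus⇔ (σ-clique F) u∈σ (τ⊆σ delete)

  link-gap-⊥ : (F : CliqueFace) → gap F ≡ ⊥ → link F ≡ Lk G (σ F)
  link-gap-⊥ F g = trans (cong (LkRel G (σ F)) (sym (to (─≡⊥⇔≡ (τ⊆σ F)) g))) (LkRel-self (σ-clique F))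

  delete-≃ : {F F' : CliqueFace} → F ≃ F' → {u u' : Fin n} (u∈ : u ∈ gap F) (u'∈ : u' ∈ gap F') →
    N G u ≡ N G u' → delete F u∈ ≃ delete F' u'∈
  delete-≃ {F} {F'} (σ≈ , τ≈) u∈ u'∈ Nu≡Nu' =
    ++-cancel-↭ (↭-reflexive (cong [_] Nu≡Nu'))
      (↭-trans (↭-sym (NU-minus (p─q⊆p _ _ u∈))) (↭-trans σ≈ (NU-minus (p─q⊆p _ _ u'∈))))
    , τ≈

  insert-≃ : {F F' : CliqueFace} → F ≃ F' → {u u' : Fin n} (u∈ : u ∈ gap F) (u'∈ : u' ∈ gap F') →
    N G u ≡ N G u' → insert F u∈ ≃ insert F' u'∈
  insert-≃ {F} {F'} (σ≈ , τ≈) u∈ u'∈ Nu≡Nu' =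
    σ≈ , ↭-trans (NU-τ-insert F u∈)
           (↭-trans (++⁺ (↭-reflexive (cong [_] Nu≡Nu')) τ≈) (↭-sym (NU-τ-insert F' u'∈)))

  module _ (regular : LinkRegular G) where

    link-≃-base : {F F' : CliqueFace} → F ≃ F' → gap F ≡ ⊥ → _≈N_ G (link F) (link F')
    link-≃-base {F} {F'} F≃F' gap≡⊥ =
      subst₂ (_≈N_ G) (sym (link-gap-⊥ F gap≡⊥)) (sym (link-gap-⊥ F' (≈N-⊥ (gap-≃ F≃F') gap≡⊥)))
        (regular (σ F) (σ F') (σ-clique F) (σ-clique F') (_≃_.σ≈ F≃F'))

    link-≃-step : ∀ {d} {F F' : CliqueFace} → F ≃ F' → {u : Fin n} (u∈ : u ∈ gap F) →
      (∀ {H H'} → H ≃ H' → length (NU G (gap H)) ≡ d → _≈N_ G (link H) (link H')) →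
      length (NU G (gap F)) ≡ suc d → _≈N_ G (link F) (link F')
    link-≃-step {d} {F} {F'} F≃F' {u} u∈ ih |gap| with ≈N-match (gap-≃ F≃F') u∈
    ... | u' , u'∈ , Nu≡Nu' =
      ++-cancel-↭ (ih F₁≃F₁' |gap₁|)
        (++-cancel-↭ (↭-reflexive heads)
          (↭-trans (↭-sym (NU-link-delete F u∈)) (↭-trans (ih F₀≃F₀' |gap₀|) (NU-link-delete F' u'∈))))
      where
      F₀≃F₀' : delete F u∈ ≃ delete F' u'∈
      F₀≃F₀' = delete-≃ F≃F' u∈ u'∈ Nu≡Nu'
      F₁≃F₁' : insert F u∈ ≃ insert F' u'∈
      F₁≃F₁' = insert-≃ F≃F' u∈ u'∈ Nu≡Nu'
      |gap₀| : length (NU G (gap (delete F u∈))) ≡ d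
      |gap₀| = suc-injective (trans (sym (↭-length (NU-gap-delete F u∈))) |gap|)
      |gap₁| : length (NU G (gap (insert F u∈))) ≡ d
      |gap₁| = trans (cong (length ∘ NU G) (gap-insert F u∈)) |gap₀|
      gap₀-⊥⇔ : gap (delete F u∈) ≡ ⊥ ⇔ gap (delete F' u'∈) ≡ ⊥
      gap₀-⊥⇔ = mk⇔ (≈N-⊥ (gap-≃ F₀≃F₀')) (≈N-⊥ (↭-sym (gap-≃ F₀≃F₀')))
      heads : NU G (link (delete F u∈) ∩ ⁅ u ⁆) ≡ NU G (link (delete F' u'∈) ∩ ⁅ u' ⁆)
      heads = NU-∩⁅⁆
        (⇔-trans (u∈link-delete⇔ F u∈) (⇔-trans gap₀-⊥⇔ (⇔-sym (u∈link-delete⇔ F' u'∈)))) Nu≡Nu'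

    link-≃ : ∀ d {F F' : CliqueFace} → F ≃ F' → length (NU G (gap F)) ≡ d → _≈N_ G (link F) (link F')
    link-≃ d {F} F≃F' |gap| with nonempty? (gap F)
    link-≃ d       F≃F' |gap| | no  empty    = link-≃-base F≃F' (Empty-unique empty)
    link-≃ zero    {F} F≃F' |gap| | yes (u , u∈) =
      contradiction (trans (sym |gap|) (↭-length (NU-gap-delete F u∈))) 0≢1+n
    link-≃ (suc d) F≃F' |gap| | yes (u , u∈) = link-≃-step F≃F' u∈ (link-≃ d) |gap|

lemma5p8 : {n : ℕ} (G : NumberedGraph n) → LinkRegular G →
    (σ σ' : Subset n) → IsClique G σ → IsClique G σ' → _≈N_ G σ σ' →
    (τ τ' : Subset n) → τ ⊆ σ → τ' ⊆ σ' → _≈N_ G τ τ' →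
    _≈N_ G (LkRel G σ τ) (LkRel G σ' τ')
lemma5p8 G regular σ σ' σ-clique σ'-clique σ≈σ' τ τ' τ⊆σ τ'⊆σ' τ≈τ' =
  link-≃ G regular _ {F} {F'} (σ≈σ' , τ≈τ') refl
  where
  F F' : CliqueFace G
  F  = record { σ = σ  ; τ = τ  ; σ-clique = σ-clique  ; τ⊆σ = τ⊆σ }
  F' = record { σ = σ' ; τ = τ' ; σ-clique = σ'-clique ; τ⊆σ = τ'⊆σ' }
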